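{- Let $m\ge 2$ be an integer. Let $A, C\ge 1$ and $B$ be integers with $0\le B<A$ such that $p(An+B)\equiv 0 \pmod{C}$ for all integers $n\ge 0$, where $p(n)$ is the number of partitions of $n$. If $A \mid m$, then for every integer $n\ge 0$ and every integer $k\ge 1$, $$p_{\rho,m}(An+B,k)\equiv 0 \pmod{C}.$$
   Context: Fix an integer $m\ge 2$. Every positive integer $N$ can be written uniquely as $N=j m^k$ with $k\ge 0$ and $m\nmid j$. For a partition $\lambda$, let $f_N$ be the number of times the part $N$ appears, and write its base-$m$ expansion $f_N=\sum_{\ell\ge 0} a_{N,\ell}\, m^\ell$ with digits $a_{N,\ell}\in\{0,1,\dots,m-1\}$. For each positive integer $j$ with $m\nmid j$, the part-frequency matrix $M_j$ of $\lambda$ (with modulus $m$) is the infinite matrix with rows and columns indexed by $0,1,2,\dots$ whose entry in row $k$, column $\ell$ is $a_{jm^k,\ell}$. The sequence $(M_j)_{m\nmid j}$ (with only finitely many nonzero entries in total) determines $\lambda$, and $|\lambda|=\sum_{j}\sum_{k,\ell} (M_j)_{k,\ell}\, j\, m^{k+\ell}$. The entries $(k,\ell)$ with $k+\ell=d$ form the $d$-th antidiagonal (of length $d+1$). The map $\rho$ (with modulus $m$) sends $\lambda$ to the partition whose matrices $M'_j$ are given by $(M'_j)_{k,\ell}=(M_j)_{k-1,\ell+1}$ for $k\ge 1$ and $(M'_j)_{0,\ell}=(M_j)_{\ell,0}$; i.e. each entry moves one place down and one place left within its antidiagonal, and the lowest entry of each antidiagonal moves to its upper end. This is a weight-preserving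 bijection on partitions of $n$, and the orbit of $\lambda$ is $\{\rho^t(\lambda): t\ge 0\}$, which is finite. $p_{\rho,m}(n,k)$ denotes the number of partitions of $n$ lying in orbits of size $k$ under $\rho$. -}

module Defs where

open import Data.Nat using (ℕ; zero; suc; _+_; _*_; _^_; _/_; _%_; NonZero)
open import Data.Nat.Properties using (m^n≢0)
open import Data.Nat.Divisibility using (_∣?_)
open import Data.Fin using (Fin; toℕ)
open import Data.Vec using (Vec; tabulate; toList)
open import Data.List using (List; length)
open import Data.List.Relation.Unary.Unique.Propositional using (Unique)
open import Data.List.Membership.Propositional using (_∈_)
open import Data.Product using (Σ; _×_; ∃-syntax)
open import Function.Bundles using (_⇔_)
open import Relation.Nullary.Decidable using (does)
open import Relation.Binary.PropositionalEquality using (_≡_)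
open import Data.Bool using (if_then_else_)

sumTo : ℕ → (ℕ → ℕ) → ℕ
sumTo zero    g = 0
sumTo (suc L) g = sumTo L g + g L

-- A (candidate) partition with all parts ≤ N is represented by its
-- frequency vector f : Vec ℕ N, where entry i is the multiplicity of the part i+1.

nth0 : List ℕ → ℕ → ℕ
nth0 List.[]       _       = 0
nth0 (x List.∷ xs) zero    = x
nth0 (x List.∷ xs) (suc i) = nth0 xs i

freq : ∀ {N} → Vec ℕ N → ℕ → ℕ
freq f zero    = 0
freq f (suc i) = nth0 (toList f) i

weight : ∀ {N} → Vec ℕ N → ℕ
weight {N} f = sumTo (suc N) (λ P → P * freq f P)

IsPartition : (n : ℕ) → Vec ℕ n → Set
IsPartition n f = weight f ≡ n

digit : (m : ℕ) .{{_ : NonZero m}} → ℕ → ℕ → ℕ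
digit m x ℓ = (x / (m ^ ℓ)) {{m^n≢0 m ℓ}} % m

newDigit : (m : ℕ) .{{_ : NonZero m}} → ∀ {N} → Vec ℕ N → ℕ → ℕ → ℕ
newDigit m f P ℓ =
  if does (m ∣? P)
  then digit m (freq f (P / m)) (suc ℓ)
  else digit m (freq f (P * m ^ ℓ)) 0

-- new frequency f'_P = Σ_ℓ a'_{P,ℓ} m^ℓ   (digits with ℓ > N vanish for partitions of N)
newFreq : (m : ℕ) .{{_ : NonZero m}} → ∀ {N} → Vec ℕ N → ℕ → ℕ
newFreq m {N} f P = sumTo (suc N) (λ ℓ → newDigit m f P ℓ * m ^ ℓ)

ρ : (m : ℕ) .{{_ : NonZero m}} → ∀ {N} → Vec ℕ N → Vec ℕ N
ρ m f = tabulate (λ (i : Fin _) → newFreq m f (suc (toℕ i)))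

iter : ∀ {A : Set} → (A → A) → ℕ → A → A
iter g zero    x = x
iter g (suc t) x = g (iter g t x)

Orbit : (m : ℕ) .{{_ : NonZero m}} → ∀ {N} → Vec ℕ N → Vec ℕ N → Set
Orbit m λ' μ = ∃[ t ] iter (ρ m) t λ' ≡ μ

Card : {A : Set} → (A → Set) → ℕ → Set
Card {A} S c = Σ (List A) (λ xs → Unique xs × ((x : A) → (x ∈ xs ⇔ S x)) × length xs ≡ c)

InOrbitOfSize : (m : ℕ) .{{_ : NonZero m}} → (n k : ℕ) → Vec ℕ n → Set
InOrbitOfSize m n k λ' = IsPartition n λ' × Card (Orbit m λ') k

-- Split a partition as μ ⊕ ν, where ν keeps the residue f_P mod m of every part P with m ∤ P (the (0,0)
-- entries of the matrices M_j) and μ is the rest, so that m ∣ |μ|. As ρ moves entries only within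
-- antidiagonals, ρ (μ ⊕ ν) = ρ μ ⊕ ν: the orbit size of λ depends only on μ. Moreover ν ↦ μ ⊕ ν is a
-- bijection from the partitions of w − |μ| with zero moving part onto those of w with moving part μ,
-- and since A ∣ m ∣ |μ|, the weight w − |μ| stays in the progression An + B. Counting the partitions of w by their μ, strong
-- induction on w shows that C divides the number of partitions of w with μ = 0, hence the size of every
-- fibre over μ of the partitions of An + B with orbit size k.

module Submission where

open import Algebra.Properties.CommutativeSemigroup using (interchange)
open import Data.Bool using (if_then_else_)
open import Data.Empty using (⊥-elim)
open import Data.Fin using (toℕ)
open import Data.List using (List; []; _∷_; length; filter; map; concatMap; upTo; deduplicate)
open import Data.List.Membership.Propositional using (_∈_)
open import Data.List.Membership.Propositional.Properties
  using (∈-filter⁺; ∈-filter⁻; ∈-map⁺; ∈-map⁻; ∈-concat⁺′; ∈-upTo⁺; ∈-deduplicate⁺)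
open import Data.List.Membership.Propositional.Properties.WithK using (unique∧set⇒bag)
open import Data.List.Properties using (length-map; length-filter; filter-reject)
open import Data.List.Relation.Binary.BagAndSetEquality using (∼bag⇒↭)
open import Data.List.Relation.Binary.Permutation.Propositional.Properties using (↭-length)
open import Data.List.Relation.Unary.All as All using (All; []; _∷_)
open import Data.List.Relation.Unary.AllPairs using ([]; _∷_)
open import Data.List.Relation.Unary.Any using (here)
open import Data.List.Relation.Unary.Unique.Propositional using (Unique)
import Data.List.Relation.Unary.Unique.Propositional.Properties as Unique
open import Data.List.Relation.Unary.Unique.DecPropositional.Properties using (deduplicate-!)
open import Data.Nat
  using (ℕ; zero; suc; _+_; _*_; _∸_; _^_; _/_; _%_; _≤_; _<_; z≤n; s≤s; s≤s⁻¹; _<?_; _≟_; NonZero; >-nonZero⁻¹)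
open import Data.Nat.DivMod
open import Data.Nat.Divisibility
open import Data.Nat.Induction using (<-rec)
open import Data.Nat.Properties
open import Data.Product using (∃-syntax; _×_; _,_; proj₁; proj₂)
open import Data.Sum using (inj₁; inj₂)
open import Data.Vec using (Vec; []; _∷_; tabulate; zipWith; replicate)
open import Data.Vec.Properties using (≡-dec)
open import Function using (_∘_; _∘′_)
open import Function.Bundles using (_⇔_; mk⇔; Equivalence)
open import Relation.Binary.Definitions using (DecidableEquality)
open import Relation.Binary.PropositionalEquality
  using (_≡_; refl; sym; trans; cong; cong₂; subst; module ≡-Reasoning)
open import Relation.Nullary using (¬_; yes; no; does; ¬?)
open import Relation.Unary using (Decidable)

open import Defs

open Equivalence using (to; from)

-- Counting finite sets

DividesCard : {A : Set} → ℕ → (A → Set) → Set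
DividesCard C S = ∀ c → Card S c → C ∣ c

module _ {A : Set} where

  Card-unique : {S : A → Set} {c c′ : ℕ} → Card S c → Card S c′ → c ≡ c′
  Card-unique (xs , xs! , ∈xs , refl) (ys , ys! , ∈ys , refl) =
    ↭-length (∼bag⇒↭ (unique∧set⇒bag xs! ys! (λ {x} →
      mk⇔ (λ p → from (∈ys x) (to (∈xs x) p)) (λ p → from (∈xs x) (to (∈ys x) p)))))

  Card-cong : {S S′ : A → Set} {c : ℕ} → (∀ x → S x ⇔ S′ x) → Card S c → Card S′ c
  Card-cong S⇔S′ (xs , xs! , ∈xs , len) =
    xs , xs! , (λ x → mk⇔ (λ p → to (S⇔S′ x) (to (∈xs x) p)) (λ s → from (∈xs x) (from (S⇔S′ x) s))) , len

  DividesCard-cong : {S S′ : A → Set} {C : ℕ} → (∀ x → S x ⇔ S′ x) → DividesCard C S′ → DividesCard C S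
  DividesCard-cong S⇔S′ C∣S′ c = C∣S′ c ∘′ Card-cong S⇔S′

  Card-filter : {S P : A → Set} (P? : Decidable P) (xs : List A) → Unique xs → (∀ x → x ∈ xs ⇔ S x) →
    Card (λ x → S x × P x) (length (filter P? xs))
  Card-filter {S} {P} P? xs xs! ∈xs = filter P? xs , Unique.filter⁺ P? {xs} xs! , ∈filter , refl
    where
    ∈filter : ∀ x → x ∈ filter P? xs ⇔ (S x × P x)
    ∈filter x = mk⇔ (λ p → let (x∈xs , Px) = ∈-filter⁻ P? p in to (∈xs x) x∈xs , Px)
                    (λ (Sx , Px) → ∈-filter⁺ P? (from (∈xs x) Sx) Px)

  Card-of-cover : {P : A → Set} (P? : Decidable P) (xs : List A) → Unique xs → (∀ x → P x → x ∈ xs) →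
    Card P (length (filter P? xs))
  Card-of-cover P? xs xs! cover = filter P? xs , Unique.filter⁺ P? {xs} xs! ,
    (λ x → mk⇔ (λ p → proj₂ (∈-filter⁻ P? {xs = xs} p)) (λ Px → ∈-filter⁺ P? (cover x Px) Px)) , refl

  length-filter-∁ : {P : A → Set} (P? : Decidable P) (xs : List A) →
    length xs ≡ length (filter P? xs) + length (filter (¬? ∘ P?) xs)
  length-filter-∁ P? [] = refl
  length-filter-∁ P? (x ∷ xs) with P? x
  ... | yes _ = cong suc (length-filter-∁ P? xs)
  ... | no _  = trans (cong suc (length-filter-∁ P? xs)) (sym (+-suc _ _))

  Card-bijection : {B : Set} {S : A → Set} {S′ : B → Set} (F : A → B) (G : B → A) →
    (∀ x → S x → S′ (F x)) → (∀ y → S′ y → S (G y)) →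
    (∀ x → S x → G (F x) ≡ x) → (∀ y → S′ y → F (G y) ≡ y) →
    ∀ {c} → Card S c → Card S′ c
  Card-bijection {S = S} {S′} F G F∈ G∈ GF FG (xs , xs! , ∈xs , refl) =
    map F xs , map-unique xs (All.tabulate (λ {x} → to (∈xs x))) xs! , ∈map , length-map F xs
    where
    F-injective : ∀ {x y} → S x → S y → F x ≡ F y → x ≡ y
    F-injective {x} {y} Sx Sy e = trans (sym (GF x Sx)) (trans (cong G e) (GF y Sy))

    map-unique : (ys : List A) → All S ys → Unique ys → Unique (map F ys)
    map-unique [] _ _ = []
    map-unique (y ∷ ys) (Sy ∷ Sys) (y∉ys ∷ ys!) = apart ys Sys y∉ys ∷ map-unique ys Sys ys!
      where
      apart : (zs : List A) → All S zs → All (λ z → ¬ y ≡ z) zs → All (λ z → ¬ F y ≡ z) (map F zs)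
      apart [] _ _ = []
      apart (z ∷ zs) (Sz ∷ Szs) (y≢z ∷ y∉zs) = (y≢z ∘ F-injective Sy Sz) ∷ apart zs Szs y∉zs

    ∈map : ∀ y → y ∈ map F xs ⇔ S′ y
    ∈map y = mk⇔ into onto
      where
      into : y ∈ map F xs → S′ y
      into p with ∈-map⁻ F p
      ... | x , x∈xs , refl = F∈ x (to (∈xs x) x∈xs)
      onto : S′ y → y ∈ map F xs
      onto S′y = subst (_∈ map F xs) (FG y S′y) (∈-map⁺ F (from (∈xs (G y)) (G∈ y S′y)))

  ∣-card-of-∣-complement : {S P : A → Set} (P? : Decidable P) {C c : ℕ} → Card S c → C ∣ c →
    DividesCard C (λ x → S x × ¬ P x) → DividesCard C (λ x → S x × P x)
  ∣-card-of-∣-complement P? {C} (xs , xs! , ∈xs , refl) C∣S C∣S∖P c S∩P =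
    subst (C ∣_) (Card-unique (Card-filter P? xs xs! ∈xs) S∩P)
      (∣m+n∣m⇒∣n (subst (C ∣_) (trans (length-filter-∁ P? xs) (+-comm (length (filter P? xs)) _)) C∣S)
                 (C∣S∖P _ (Card-filter (¬? ∘ P?) xs xs! ∈xs)))

  ∣-card-of-∣-fibres : {B : Set} (_≟_ : DecidableEquality B) (π : A → B) {S : A → Set} {C c : ℕ} →
    Card S c → (∀ x → S x → DividesCard C (λ y → S y × π y ≡ π x)) → C ∣ c
  ∣-card-of-∣-fibres _≟_ π {C = C} card = go _ card ≤-refl
    where
    same? : (x : A) → Decidable (λ y → π y ≡ π x)
    same? x y = π y ≟ π x

    go : ∀ {S} {c} n → Card S c → c ≤ n → (∀ x → S x → DividesCard C (λ y → S y × π y ≡ π x)) → C ∣ c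
    go _ ([] , _ , _ , refl) _ _ = C ∣0
    go {S} (suc n) (x ∷ xs , x∷xs! , ∈x∷xs , refl) (s≤s |xs|≤n) C∣fibres =
      subst (C ∣_) (sym (length-filter-∁ (same? x) (x ∷ xs)))
        (∣m∣n⇒∣m+n (C∣fibres x Sx _ (Card-filter (same? x) (x ∷ xs) x∷xs! ∈x∷xs))
                   (go n (Card-filter (¬? ∘ same? x) (x ∷ xs) x∷xs! ∈x∷xs) rest≤n C∣rest-fibres))
      where
      Sx : S x
      Sx = to (∈x∷xs x) (here refl)

      rest≤n : length (filter (¬? ∘ same? x) (x ∷ xs)) ≤ n
      rest≤n rewrite filter-reject (¬? ∘ same? x) {xs = xs} (λ πx≢πx → πx≢πx refl) =
        ≤-trans (length-filter (¬? ∘ same? x) xs) |xs|≤n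

      C∣rest-fibres : ∀ z → S z × ¬ π z ≡ π x → DividesCard C (λ y → (S y × ¬ π y ≡ π x) × π y ≡ π z)
      C∣rest-fibres z (Sz , πz≢πx) = DividesCard-cong
        (λ y → mk⇔ (λ ((Sy , _) , πy≡πz) → Sy , πy≡πz)
                   (λ (Sy , πy≡πz) → (Sy , λ πy≡πx → πz≢πx (trans (sym πy≡πz) πy≡πx)) , πy≡πz))
        (C∣fibres z Sz)

module _ {X : Set} (σ : X → X) where

  Card-orbit-image : (F G : X → X) → (∀ x → G (F x) ≡ x) → ∀ {a} → (∀ t → iter σ t (F a) ≡ F (iter σ t a)) →
    ∀ {k} → Card (λ x → ∃[ t ] iter σ t a ≡ x) k ⇔ Card (λ y → ∃[ t ] iter σ t (F a) ≡ y) k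
  Card-orbit-image F G GF {a} σᵗF≡Fσᵗ =
    mk⇔ (Card-bijection F G F∈ G∈ (λ x _ → GF x) FG) (Card-bijection G F G∈ F∈ FG (λ x _ → GF x))
    where
    F∈ : ∀ x → ∃[ t ] iter σ t a ≡ x → ∃[ t ] iter σ t (F a) ≡ F x
    F∈ x (t , σᵗa≡x) = t , trans (σᵗF≡Fσᵗ t) (cong F σᵗa≡x)

    G∈ : ∀ y → ∃[ t ] iter σ t (F a) ≡ y → ∃[ t ] iter σ t a ≡ G y
    G∈ y (t , σᵗFa≡y) = t , trans (sym (GF _)) (cong G (trans (sym (σᵗF≡Fσᵗ t)) σᵗFa≡y))

    FG : ∀ y → ∃[ t ] iter σ t (F a) ≡ y → F (G y) ≡ y
    FG y (t , refl) = begin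
      F (G (iter σ t (F a)))  ≡⟨ cong (F ∘ G) (σᵗF≡Fσᵗ t) ⟩
      F (G (F (iter σ t a)))  ≡⟨ cong F (GF _) ⟩
      F (iter σ t a)          ≡⟨ σᵗF≡Fσᵗ t ⟨
      iter σ t (F a)          ∎
      where open ≡-Reasoning

-- Frequency vectors

sumTo-cong : ∀ n {g h : ℕ → ℕ} → (∀ i → g i ≡ h i) → sumTo n g ≡ sumTo n h
sumTo-cong zero    g≗h = refl
sumTo-cong (suc n) g≗h = cong₂ _+_ (sumTo-cong n g≗h) (g≗h n)

sumTo-+ : ∀ n (g h : ℕ → ℕ) → sumTo n (λ i → g i + h i) ≡ sumTo n g + sumTo n h
sumTo-+ zero    g h = refl
sumTo-+ (suc n) g h = trans (cong (_+ (g n + h n)) (sumTo-+ n g h))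
                            (interchange +-commutativeSemigroup (sumTo n g) (sumTo n h) (g n) (h n))

sumTo-+-at-0 : ∀ n {g g′ : ℕ → ℕ} c → g′ 0 ≡ g 0 + c → (∀ i → g′ (suc i) ≡ g (suc i)) →
  sumTo (suc n) g′ ≡ sumTo (suc n) g + c
sumTo-+-at-0 zero    {g} c g′0 _ = trans (cong (0 +_) g′0) (sym (+-assoc 0 (g 0) c))
sumTo-+-at-0 (suc n) {g} {g′} c g′0 g′suc = begin
  sumTo (suc n) g′ + g′ (suc n)       ≡⟨ cong₂ _+_ (sumTo-+-at-0 n c g′0 g′suc) (g′suc n) ⟩
  sumTo (suc n) g + c + g (suc n)     ≡⟨ +-assoc (sumTo (suc n) g) c (g (suc n)) ⟩
  sumTo (suc n) g + (c + g (suc n))   ≡⟨ cong (sumTo (suc n) g +_) (+-comm c (g (suc n))) ⟩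
  sumTo (suc n) g + (g (suc n) + c)   ≡⟨ sym (+-assoc (sumTo (suc n) g) (g (suc n)) c) ⟩
  sumTo (suc (suc n)) g + c           ∎
  where open ≡-Reasoning

sumTo-vanishing : ∀ a k (g : ℕ → ℕ) → (∀ i → a ≤ i → g i ≡ 0) → sumTo (k + a) g ≡ sumTo a g
sumTo-vanishing a zero    g g≡0 = refl
sumTo-vanishing a (suc k) g g≡0 = trans (cong₂ _+_ (sumTo-vanishing a k g g≡0) (g≡0 (k + a) (m≤n+m a k))) (+-identityʳ _)

term≤sumTo : ∀ n (g : ℕ → ℕ) {i} → i < n → g i ≤ sumTo n g
term≤sumTo (suc n) g {i} (s≤s i≤n) with m≤n⇒m<n∨m≡n i≤n
... | inj₁ i<n  = ≤-trans (term≤sumTo n g i<n) (m≤m+n _ _)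
... | inj₂ refl = m≤n+m _ _

∣-sumTo : ∀ {d} n (g : ℕ → ℕ) → (∀ i → d ∣ g i) → d ∣ sumTo n g
∣-sumTo {d} zero    g d∣g = d ∣0
∣-sumTo     (suc n) g d∣g = ∣m∣n⇒∣m+n (∣-sumTo n g d∣g) (d∣g n)

freq-beyond : ∀ {L} (f : Vec ℕ L) {P} → L < P → freq f P ≡ 0
freq-beyond []      {suc P}       _          = refl
freq-beyond (x ∷ f) {suc (suc P)} (s≤s L<P) = freq-beyond f L<P

freq-ext : ∀ {L} (f g : Vec ℕ L) → (∀ p → p < L → freq f (suc p) ≡ freq g (suc p)) → f ≡ g
freq-ext []      []      _      = refl
freq-ext (x ∷ f) (y ∷ g) f≗g = cong₂ _∷_ (f≗g 0 (s≤s z≤n)) (freq-ext f g (λ p p<L → f≗g (suc p) (s≤s p<L)))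

fromFreq : ∀ {L} → (ℕ → ℕ) → Vec ℕ L
fromFreq h = tabulate (λ i → h (suc (toℕ i)))

freq-fromFreq : ∀ L (h : ℕ → ℕ) {p} → p < L → freq (fromFreq {L} h) (suc p) ≡ h (suc p)
freq-fromFreq (suc L) h {zero}  _         = refl
freq-fromFreq (suc L) h {suc p} (s≤s p<L) = freq-fromFreq L (h ∘ suc) p<L

freq-fromFreq-supported : ∀ L (h : ℕ → ℕ) → h 0 ≡ 0 → (∀ P → L < P → h P ≡ 0) →
  ∀ P → freq (fromFreq {L} h) P ≡ h P
freq-fromFreq-supported L h h0≡0 h≡0 zero = sym h0≡0
freq-fromFreq-supported L h h0≡0 h≡0 (suc p) with p <? L
... | yes p<L = freq-fromFreq L h p<L
... | no  p≮L = trans (freq-beyond (fromFreq h) (s≤s (≮⇒≥ p≮L))) (sym (h≡0 (suc p) (s≤s (≮⇒≥ p≮L))))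

freq-zipWith : (_∙_ : ℕ → ℕ → ℕ) → 0 ∙ 0 ≡ 0 →
  ∀ {L} (f g : Vec ℕ L) P → freq (zipWith _∙_ f g) P ≡ freq f P ∙ freq g P
freq-zipWith _∙_ 0∙0≡0 []      []      zero          = sym 0∙0≡0
freq-zipWith _∙_ 0∙0≡0 []      []      (suc _)       = sym 0∙0≡0
freq-zipWith _∙_ 0∙0≡0 (x ∷ f) (y ∷ g) zero          = sym 0∙0≡0
freq-zipWith _∙_ 0∙0≡0 (x ∷ f) (y ∷ g) (suc zero)    = refl
freq-zipWith _∙_ 0∙0≡0 (x ∷ f) (y ∷ g) (suc (suc p)) = freq-zipWith _∙_ 0∙0≡0 f g (suc p)

infixl 6 _⊕_ _⊖_

_⊕_ : ∀ {L} → Vec ℕ L → Vec ℕ L → Vec ℕ L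
_⊕_ = zipWith _+_

_⊖_ : ∀ {L} → Vec ℕ L → Vec ℕ L → Vec ℕ L
_⊖_ = zipWith _∸_

freq-⊕ : ∀ {L} (f g : Vec ℕ L) P → freq (f ⊕ g) P ≡ freq f P + freq g P
freq-⊕ = freq-zipWith _+_ refl

freq-⊖ : ∀ {L} (f g : Vec ℕ L) P → freq (f ⊖ g) P ≡ freq f P ∸ freq g P
freq-⊖ = freq-zipWith _∸_ refl

⊕-⊖-cancel : ∀ {L} (f g : Vec ℕ L) → f ⊕ g ⊖ g ≡ f
⊕-⊖-cancel []      []      = refl
⊕-⊖-cancel (x ∷ f) (y ∷ g) = cong₂ _∷_ (m+n∸n≡m x y) (⊕-⊖-cancel f g)

zeros : ∀ {L} → Vec ℕ L
zeros {L} = replicate L 0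

freq-zeros : ∀ {L} P → freq (zeros {L}) P ≡ 0
freq-zeros {zero}  zero          = refl
freq-zeros {zero}  (suc _)       = refl
freq-zeros {suc L} zero          = refl
freq-zeros {suc L} (suc zero)    = refl
freq-zeros {suc L} (suc (suc p)) = freq-zeros {L} (suc p)

weight-vanishing : ∀ {L} (f : Vec ℕ L) k → sumTo (k + suc L) (λ P → P * freq f P) ≡ weight f
weight-vanishing {L} f k = sumTo-vanishing (suc L) k _ (λ P L<P → trans (cong (P *_) (freq-beyond f L<P)) (*-zeroʳ P))

weight-cong : ∀ {L L′} (f : Vec ℕ L) (g : Vec ℕ L′) → L′ ≤ L →
  (∀ P → freq f P ≡ freq g P) → weight f ≡ weight g
weight-cong {L} {L′} f g L′≤L f≗g = begin
  sumTo (suc L) (λ P → P * freq f P)            ≡⟨ sumTo-cong (suc L) (λ P → cong (P *_) (f≗g P)) ⟩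
  sumTo (suc L) (λ P → P * freq g P)            ≡⟨ cong (λ n → sumTo n (λ P → P * freq g P)) L′-padded ⟨
  sumTo (L ∸ L′ + suc L′) (λ P → P * freq g P)  ≡⟨ weight-vanishing g (L ∸ L′) ⟩
  weight g                                      ∎
  where
  open ≡-Reasoning
  L′-padded : L ∸ L′ + suc L′ ≡ suc L
  L′-padded = trans (+-suc (L ∸ L′) L′) (cong suc (m∸n+n≡m L′≤L))

weight-⊕ : ∀ {L} (f g : Vec ℕ L) → weight (f ⊕ g) ≡ weight f + weight g
weight-⊕ {L} f g = trans (sumTo-cong (suc L) (λ P → trans (cong (P *_) (freq-⊕ f g P)) (*-distribˡ-+ P _ _)))
                         (sumTo-+ (suc L) (λ P → P * freq f P) (λ P → P * freq g P))

*-freq≤weight : ∀ {L} (f : Vec ℕ L) P → P * freq f P ≤ weight f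
*-freq≤weight {L} f P with P <? suc L
... | yes P≤L = term≤sumTo (suc L) (λ P → P * freq f P) P≤L
... | no  P≰L = subst (_≤ weight f) (sym (trans (cong (P *_) (freq-beyond f (≮⇒≥ P≰L))) (*-zeroʳ P))) z≤n

freq≤weight : ∀ {L} (f : Vec ℕ L) P → freq f P ≤ weight f
freq≤weight f zero    = z≤n
freq≤weight f (suc p) = ≤-trans (m≤m+n (freq f (suc p)) _) (*-freq≤weight f (suc p))

freq-beyond-weight : ∀ {L} (f : Vec ℕ L) {P} → weight f < P → freq f P ≡ 0
freq-beyond-weight f {P} |f|<P with freq f P in fP
... | zero  = refl
... | suc x = ⊥-elim (<⇒≱ |f|<P (≤-trans (m≤m*n P (suc x)) (subst (λ z → P * z ≤ weight f) fP (*-freq≤weight f P))))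

weight≡0⇒≡zeros : ∀ {L} (f : Vec ℕ L) → weight f ≡ 0 → f ≡ zeros
weight≡0⇒≡zeros {L} f |f|≡0 = freq-ext f zeros λ p _ →
  trans (n≤0⇒n≡0 (subst (freq f (suc p) ≤_) |f|≡0 (freq≤weight f (suc p)))) (sym (freq-zeros {L} (suc p)))

⊕-identityˡ : ∀ {L} (f : Vec ℕ L) → zeros ⊕ f ≡ f
⊕-identityˡ []      = refl
⊕-identityˡ (x ∷ f) = cong (x ∷_) (⊕-identityˡ f)

-- Moving and fixed parts of a partition

module _ (m : ℕ) .{{_ : NonZero m}} where

  -- For m ∤ P, x % m is the entry (0,0) of the matrix M_P, an antidiagonal of length one that ρ never moves.
  fixedDigit : ℕ → ℕ → ℕ
  fixedDigit P x = if does (m ∣? P) then 0 else x % m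

  fixedDigit-∣ : ∀ {P} x → m ∣ P → fixedDigit P x ≡ 0
  fixedDigit-∣ {P} x m∣P with m ∣? P
  ... | yes _   = refl
  ... | no  m∤P = ⊥-elim (m∤P m∣P)

  fixedDigit-∤ : ∀ {P} x → ¬ m ∣ P → fixedDigit P x ≡ x % m
  fixedDigit-∤ {P} x m∤P with m ∣? P
  ... | yes m∣P = ⊥-elim (m∤P m∣P)
  ... | no  _   = refl

  fixedDigit≤ : ∀ P x → fixedDigit P x ≤ x
  fixedDigit≤ P x with m ∣? P
  ... | yes _ = z≤n
  ... | no  _ = m%n≤m x m

  fixedDigit< : ∀ P x → fixedDigit P x < m
  fixedDigit< P x with m ∣? P
  ... | yes _ = >-nonZero⁻¹ m
  ... | no  _ = m%n<n x m

  fixedDigit-+ : ∀ P {x y} → (¬ m ∣ P → m ∣ x) → (m ∣ P → y ≡ 0) → y < m → fixedDigit P (x + y) ≡ y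
  fixedDigit-+ P {x} {y} m∣x y≡0 y<m with m ∣? P
  ... | yes m∣P = sym (y≡0 m∣P)
  ... | no  m∤P = trans (%-remove-+ˡ y (m∣x m∤P)) (m<n⇒m%n≡m y<m)

  NoFixedDigit : ∀ {L} → Vec ℕ L → Set
  NoFixedDigit a = ∀ P → ¬ m ∣ P → m ∣ freq a P

  OnlyFixedDigits : ∀ {L} → Vec ℕ L → Set
  OnlyFixedDigits b = ∀ P → (m ∣ P → freq b P ≡ 0) × freq b P < m

  fixedPart : ∀ {L} → Vec ℕ L → Vec ℕ L
  fixedPart f = fromFreq (λ P → fixedDigit P (freq f P))

  movingPart : ∀ {L} → Vec ℕ L → Vec ℕ L
  movingPart f = f ⊖ fixedPart f

  freq-fixedPart : ∀ {L} (f : Vec ℕ L) P → freq (fixedPart f) P ≡ fixedDigit P (freq f P)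
  freq-fixedPart {L} f = freq-fromFreq-supported L _ (vanishes 0 refl) (λ P L<P → vanishes P (freq-beyond f L<P))
    where
    vanishes : ∀ P → freq f P ≡ 0 → fixedDigit P (freq f P) ≡ 0
    vanishes P fP≡0 = n≤0⇒n≡0 (subst (fixedDigit P (freq f P) ≤_) fP≡0 (fixedDigit≤ P (freq f P)))

  freq-movingPart : ∀ {L} (f : Vec ℕ L) P → freq (movingPart f) P ≡ freq f P ∸ fixedDigit P (freq f P)
  freq-movingPart f P = trans (freq-⊖ f (fixedPart f) P) (cong (freq f P ∸_) (freq-fixedPart f P))

  movingPart-⊕-fixedPart : ∀ {L} (f : Vec ℕ L) → movingPart f ⊕ fixedPart f ≡ f
  movingPart-⊕-fixedPart f = freq-ext _ f λ p _ → let P = suc p in begin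
    freq (movingPart f ⊕ fixedPart f) P            ≡⟨ freq-⊕ (movingPart f) (fixedPart f) P ⟩
    freq (movingPart f) P + freq (fixedPart f) P   ≡⟨ cong₂ _+_ (freq-movingPart f P) (freq-fixedPart f P) ⟩
    freq f P ∸ fixedDigit P (freq f P) + fixedDigit P (freq f P) ≡⟨ m∸n+n≡m (fixedDigit≤ P (freq f P)) ⟩
    freq f P                                       ∎
    where open ≡-Reasoning

  noFixedDigit-movingPart : ∀ {L} (f : Vec ℕ L) → NoFixedDigit (movingPart f)
  noFixedDigit-movingPart f P m∤P =
    subst (m ∣_) (sym (trans (freq-movingPart f P) (cong (freq f P ∸_) (fixedDigit-∤ (freq f P) m∤P))))
      (m∣x∸x%m (freq f P))
    where
    m∣x∸x%m : ∀ x → m ∣ x ∸ x % m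
    m∣x∸x%m x = divides (x / m) (trans (cong (_∸ x % m) (m≡m%n+[m/n]*n x m)) (m+n∸m≡n (x % m) _))

  onlyFixedDigits-fixedPart : ∀ {L} (f : Vec ℕ L) → OnlyFixedDigits (fixedPart f)
  onlyFixedDigits-fixedPart f P rewrite freq-fixedPart f P = fixedDigit-∣ (freq f P) , fixedDigit< P (freq f P)

  module _ {L} {a b : Vec ℕ L} (a-noFixed : NoFixedDigit a) (b-onlyFixed : OnlyFixedDigits b) where

    fixedPart-⊕ : fixedPart (a ⊕ b) ≡ b
    fixedPart-⊕ = freq-ext _ b λ p _ → let P = suc p in begin
      freq (fixedPart (a ⊕ b)) P          ≡⟨ freq-fixedPart (a ⊕ b) P ⟩
      fixedDigit P (freq (a ⊕ b) P)       ≡⟨ cong (fixedDigit P) (freq-⊕ a b P) ⟩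
      fixedDigit P (freq a P + freq b P)  ≡⟨ fixedDigit-+ P (a-noFixed P) (proj₁ (b-onlyFixed P)) (proj₂ (b-onlyFixed P)) ⟩
      freq b P                            ∎
      where open ≡-Reasoning

    movingPart-⊕ : movingPart (a ⊕ b) ≡ a
    movingPart-⊕ = trans (cong (a ⊕ b ⊖_) fixedPart-⊕) (⊕-⊖-cancel a b)

  onlyFixedDigits⇒movingPart≡zeros : ∀ {L} (b : Vec ℕ L) → OnlyFixedDigits b → movingPart b ≡ zeros
  onlyFixedDigits⇒movingPart≡zeros b b-onlyFixed =
    subst (λ z → movingPart z ≡ zeros) (⊕-identityˡ b) (movingPart-⊕ zeros-noFixed b-onlyFixed)
    where
    zeros-noFixed : NoFixedDigit zeros
    zeros-noFixed P _ = subst (m ∣_) (sym (freq-zeros P)) (m ∣0)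

  movingPart≡zeros⇒onlyFixedDigits : ∀ {L} (g : Vec ℕ L) → movingPart g ≡ zeros → OnlyFixedDigits g
  movingPart≡zeros⇒onlyFixedDigits g moving≡0 = subst OnlyFixedDigits g≡fixed (onlyFixedDigits-fixedPart g)
    where
    g≡fixed : fixedPart g ≡ g
    g≡fixed = begin
      fixedPart g                  ≡⟨ ⊕-identityˡ (fixedPart g) ⟨
      zeros ⊕ fixedPart g          ≡⟨ cong (_⊕ fixedPart g) moving≡0 ⟨
      movingPart g ⊕ fixedPart g   ≡⟨ movingPart-⊕-fixedPart g ⟩
      g                            ∎
      where open ≡-Reasoning

  ∣-weight : ∀ {L} (a : Vec ℕ L) → NoFixedDigit a → m ∣ weight a
  ∣-weight {L} a a-noFixed = ∣-sumTo (suc L) _ m∣term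
    where
    m∣term : ∀ P → m ∣ P * freq a P
    m∣term P with m ∣? P
    ... | yes m∣P = ∣-trans m∣P (m∣m*n (freq a P))
    ... | no  m∤P = ∣-trans (a-noFixed P m∤P) (n∣m*n P)

  weight-movingPart-fixedPart : ∀ {L} (f : Vec ℕ L) → weight f ≡ weight (movingPart f) + weight (fixedPart f)
  weight-movingPart-fixedPart f =
    trans (cong weight (sym (movingPart-⊕-fixedPart f))) (weight-⊕ (movingPart f) (fixedPart f))

  weight-movingPart≤ : ∀ {L} (f : Vec ℕ L) → weight (movingPart f) ≤ weight f
  weight-movingPart≤ f = subst (weight (movingPart f) ≤_) (sym (weight-movingPart-fixedPart f)) (m≤m+n _ _)

  digit-zero : ∀ x → digit m x 0 ≡ x % m
  digit-zero x = cong (_% m) (n/1≡n x)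

  digit-suc-+ : ∀ {x y} ℓ → m ∣ x → y < m → digit m (x + y) (suc ℓ) ≡ digit m x (suc ℓ)
  digit-suc-+ {x} {y} ℓ m∣x y<m = cong (_% m) (begin
      (x + y) / (m * m ^ ℓ)  ≡⟨ m/n/o≡m/[n*o] (x + y) m (m ^ ℓ) ⟨
      (x + y) / m / m ^ ℓ    ≡⟨ cong (_/ m ^ ℓ) [x+y]/m≡x/m ⟩
      x / m / m ^ ℓ          ≡⟨ m/n/o≡m/[n*o] x m (m ^ ℓ) ⟩
      x / (m * m ^ ℓ)        ∎)
    where
    open ≡-Reasoning
    instance
      _ = m^n≢0 m ℓ
      _ = m^n≢0 m (suc ℓ)
    [x+y]/m≡x/m : (x + y) / m ≡ x / m
    [x+y]/m≡x/m = trans (+-distrib-/-∣ˡ y m∣x) (trans (cong (x / m +_) (m<n⇒m/n≡0 y<m)) (+-identityʳ _))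

  module _ {L} {a b : Vec ℕ L} (a-noFixed : NoFixedDigit a) (b-onlyFixed : OnlyFixedDigits b) where

    freq-⊕-∣ : ∀ {Q} → m ∣ Q → freq (a ⊕ b) Q ≡ freq a Q
    freq-⊕-∣ {Q} m∣Q = trans (freq-⊕ a b Q) (trans (cong (freq a Q +_) (proj₁ (b-onlyFixed Q) m∣Q)) (+-identityʳ _))

    digit-suc-⊕ : ∀ Q ℓ → digit m (freq (a ⊕ b) Q) (suc ℓ) ≡ digit m (freq a Q) (suc ℓ)
    digit-suc-⊕ Q ℓ with m ∣? Q
    ... | yes m∣Q = cong (λ x → digit m x (suc ℓ)) (freq-⊕-∣ m∣Q)
    ... | no  m∤Q = trans (cong (λ x → digit m x (suc ℓ)) (freq-⊕ a b Q))
                          (digit-suc-+ ℓ (a-noFixed Q m∤Q) (proj₂ (b-onlyFixed Q)))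

    newDigit-⊕-suc : ∀ P ℓ → newDigit m (a ⊕ b) P (suc ℓ) ≡ newDigit m a P (suc ℓ)
    newDigit-⊕-suc P ℓ with m ∣? P
    ... | yes _ = digit-suc-⊕ (P / m) (suc ℓ)
    ... | no  _ = cong (λ x → digit m x 0) (freq-⊕-∣ (∣-trans (m∣m*n (m ^ ℓ)) (n∣m*n P)))

    newDigit-⊕-zero : ∀ P → newDigit m (a ⊕ b) P 0 ≡ newDigit m a P 0 + freq b P
    newDigit-⊕-zero P with m ∣? P
    ... | yes m∣P = begin
      digit m (freq (a ⊕ b) (P / m)) 1       ≡⟨ digit-suc-⊕ (P / m) 0 ⟩
      digit m (freq a (P / m)) 1             ≡⟨ +-identityʳ _ ⟨
      digit m (freq a (P / m)) 1 + 0         ≡⟨ cong (_ +_) (proj₁ (b-onlyFixed P) m∣P) ⟨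
      digit m (freq a (P / m)) 1 + freq b P  ∎
      where open ≡-Reasoning
    ... | no  m∤P rewrite *-identityʳ P = begin
      digit m (freq (a ⊕ b) P) 0             ≡⟨ trans (digit-zero _) (cong (_% m) (freq-⊕ a b P)) ⟩
      (freq a P + freq b P) % m              ≡⟨ fixedDigit-∤ _ m∤P ⟨
      fixedDigit P (freq a P + freq b P)     ≡⟨ fixedDigit-+ P (a-noFixed P) (proj₁ (b-onlyFixed P)) (proj₂ (b-onlyFixed P)) ⟩
      freq b P                               ≡⟨ cong (_+ freq b P) (trans (digit-zero _) (n∣m⇒m%n≡0 _ m (a-noFixed P m∤P))) ⟨
      digit m (freq a P) 0 + freq b P        ∎
      where open ≡-Reasoning

    ρ-⊕ : ρ m (a ⊕ b) ≡ ρ m a ⊕ b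
    ρ-⊕ = freq-ext _ _ λ p p<L → let P = suc p in begin
      freq (ρ m (a ⊕ b)) P         ≡⟨ freq-fromFreq L (newFreq m (a ⊕ b)) p<L ⟩
      newFreq m (a ⊕ b) P          ≡⟨ sumTo-+-at-0 L (freq b P) (term-0 P) (λ ℓ → cong (_* m ^ suc ℓ) (newDigit-⊕-suc P ℓ)) ⟩
      newFreq m a P + freq b P     ≡⟨ cong (_+ freq b P) (freq-fromFreq L (newFreq m a) p<L) ⟨
      freq (ρ m a) P + freq b P    ≡⟨ freq-⊕ (ρ m a) b P ⟨
      freq (ρ m a ⊕ b) P           ∎
      where
      open ≡-Reasoning
      term-0 : ∀ P → newDigit m (a ⊕ b) P 0 * 1 ≡ newDigit m a P 0 * 1 + freq b P
      term-0 P = trans (*-identityʳ _) (trans (newDigit-⊕-zero P) (cong (_+ freq b P) (sym (*-identityʳ _))))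

  noFixedDigit-ρ : ∀ {L} (a : Vec ℕ L) → NoFixedDigit a → NoFixedDigit (ρ m a)
  noFixedDigit-ρ {L} a a-noFixed zero    _   = m ∣0
  noFixedDigit-ρ {L} a a-noFixed (suc p) m∤P with p <? L
  ... | no  p≮L = subst (m ∣_) (sym (freq-beyond (ρ m a) (s≤s (≮⇒≥ p≮L)))) (m ∣0)
  ... | yes p<L = subst (m ∣_) (sym (freq-fromFreq L (newFreq m a) p<L)) (∣-sumTo (suc L) _ (m∣term (suc p) m∤P))
    where
    m∣term : ∀ P → ¬ m ∣ P → ∀ ℓ → m ∣ newDigit m a P ℓ * m ^ ℓ
    m∣term P m∤P ℓ with m ∣? P
    m∣term P m∤P ℓ       | yes m∣P = ⊥-elim (m∤P m∣P)
    m∣term P m∤P zero    | no  _   = subst (m ∣_) (sym digit₀≡0) (m ∣0)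
      where
      digit₀≡0 : digit m (freq a (P * 1)) 0 * 1 ≡ 0
      digit₀≡0 = trans (*-identityʳ _) (trans (cong (λ Q → digit m (freq a Q) 0) (*-identityʳ P))
                   (trans (digit-zero _) (n∣m⇒m%n≡0 _ m (a-noFixed P m∤P))))
    m∣term P m∤P (suc ℓ) | no  _   = ∣-trans (m∣m*n (m ^ ℓ)) (n∣m*n (digit m (freq a (P * m ^ suc ℓ)) 0))

  iter-ρ-⊕ : ∀ {L} {a b : Vec ℕ L} → NoFixedDigit a → OnlyFixedDigits b →
    ∀ t → NoFixedDigit (iter (ρ m) t a) × iter (ρ m) t (a ⊕ b) ≡ iter (ρ m) t a ⊕ b
  iter-ρ-⊕ a-noFixed b-onlyFixed zero = a-noFixed , refl
  iter-ρ-⊕ {a = a} a-noFixed b-onlyFixed (suc t) with iter-ρ-⊕ a-noFixed b-onlyFixed t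
  ... | ρᵗa-noFixed , ρᵗ-⊕ =
    noFixedDigit-ρ _ ρᵗa-noFixed , trans (cong (ρ m) ρᵗ-⊕) (ρ-⊕ ρᵗa-noFixed b-onlyFixed)

  Card-Orbit-movingPart : ∀ {L} (f : Vec ℕ L) {k} → Card (Orbit m (movingPart f)) k ⇔ Card (Orbit m f) k
  Card-Orbit-movingPart f =
    subst (λ g → Card (Orbit m (movingPart f)) _ ⇔ Card (Orbit m g) _) (movingPart-⊕-fixedPart f)
      (Card-orbit-image (ρ m) (_⊕ fixedPart f) (_⊖ fixedPart f) (λ x → ⊕-⊖-cancel x (fixedPart f))
        (λ t → proj₂ (iter-ρ-⊕ (noFixedDigit-movingPart f) (onlyFixedDigits-fixedPart f) t)))

  Card-Orbit-cong : ∀ {L} (f g : Vec ℕ L) {k} → movingPart f ≡ movingPart g → Card (Orbit m f) k → Card (Orbit m g) k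
  Card-Orbit-cong f g moving-f≡g =
    to (Card-Orbit-movingPart g) ∘ subst (λ a → Card (Orbit m a) _) moving-f≡g ∘ from (Card-Orbit-movingPart f)

  Fibre : ∀ {L} → ℕ → Vec ℕ L → Vec ℕ L → Set
  Fibre w a g = weight g ≡ w × movingPart g ≡ a

  Card-Fibre-shift : ∀ {L w c} (a : Vec ℕ L) → NoFixedDigit a → weight a ≤ w →
    Card (Fibre w a) c → Card (Fibre (w ∸ weight a) zeros) c
  Card-Fibre-shift {w = w} a a-noFixed |a|≤w =
    Card-bijection fixedPart (a ⊕_) fixedPart∈ ⊕∈ a⊕fixedPart fixedPart-a⊕
    where
    fixedPart∈ : ∀ f → Fibre w a f → Fibre (w ∸ weight a) zeros (fixedPart f)
    fixedPart∈ f (|f| , refl) =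
      sym (trans (cong (_∸ weight (movingPart f)) (trans (sym |f|) (weight-movingPart-fixedPart f)))
                 (m+n∸m≡n (weight (movingPart f)) _)) ,
      onlyFixedDigits⇒movingPart≡zeros (fixedPart f) (onlyFixedDigits-fixedPart f)

    ⊕∈ : ∀ g → Fibre (w ∸ weight a) zeros g → Fibre w a (a ⊕ g)
    ⊕∈ g (|g| , moving-g) =
      trans (weight-⊕ a g) (trans (cong (weight a +_) |g|) (m+[n∸m]≡n |a|≤w)) ,
      movingPart-⊕ a-noFixed (movingPart≡zeros⇒onlyFixedDigits g moving-g)

    a⊕fixedPart : ∀ f → Fibre w a f → a ⊕ fixedPart f ≡ f
    a⊕fixedPart f (_ , refl) = movingPart-⊕-fixedPart f

    fixedPart-a⊕ : ∀ g → Fibre (w ∸ weight a) zeros g → fixedPart (a ⊕ g) ≡ g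
    fixedPart-a⊕ g (_ , moving-g) = fixedPart-⊕ a-noFixed (movingPart≡zeros⇒onlyFixedDigits g moving-g)

-- Counting partitions in the progression An + B

_≟ᵥ_ : ∀ {L} → DecidableEquality (Vec ℕ L)
_≟ᵥ_ = ≡-dec _≟_

vecsUpTo : ℕ → (L : ℕ) → List (Vec ℕ L)
vecsUpTo b zero    = [] ∷ []
vecsUpTo b (suc L) = concatMap (λ x → map (x ∷_) (vecsUpTo b L)) (upTo (suc b))

∈-vecsUpTo : ∀ {b L} (f : Vec ℕ L) → (∀ P → freq f P ≤ b) → f ∈ vecsUpTo b L
∈-vecsUpTo []      _    = here refl
∈-vecsUpTo (x ∷ f) f≤b =
  ∈-concat⁺′ (∈-map⁺ (x ∷_) (∈-vecsUpTo f (λ { zero → z≤n ; (suc p) → f≤b (suc (suc p)) })))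
             (∈-map⁺ _ (∈-upTo⁺ (s≤s (f≤b 1))))

Card-weight : ∀ L w → ∃[ c ] Card (λ (f : Vec ℕ L) → weight f ≡ w) c
Card-weight L w =
  _ , Card-of-cover (λ f → weight f ≟ w) (deduplicate _≟ᵥ_ (vecsUpTo w L)) (deduplicate-! _≟ᵥ_ _) λ f |f| → ∈-deduplicate⁺ _≟ᵥ_ (∈-vecsUpTo f (λ P → subst (freq f P ≤_) |f| (freq≤weight f P)))

resize : ∀ {L L′} → Vec ℕ L → Vec ℕ L′
resize f = fromFreq (freq f)

freq-resize : ∀ {L L′} (f : Vec ℕ L) → (∀ P → L′ < P → freq f P ≡ 0) →
  ∀ P → freq (resize {L′ = L′} f) P ≡ freq f P
freq-resize {L′ = L′} f = freq-fromFreq-supported L′ (freq f) refl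

DividesCard-resize : ∀ {C w L} → w ≤ L → DividesCard C (IsPartition w) →
  DividesCard C (λ (f : Vec ℕ L) → weight f ≡ w)
DividesCard-resize {C} {w} {L} w≤L C∣p c card =
  C∣p c (Card-bijection resize resize shorten∈ lengthen∈ lengthen-shorten shorten-lengthen card)
  where
  shorten : ∀ (f : Vec ℕ L) → weight f ≡ w → ∀ P → freq (resize {L′ = w} f) P ≡ freq f P
  shorten f |f| = freq-resize f (λ P w<P → freq-beyond-weight f (subst (_< P) (sym |f|) w<P))
  lengthen : ∀ (g : Vec ℕ w) P → freq (resize {L′ = L} g) P ≡ freq g P
  lengthen g = freq-resize g (λ P L<P → freq-beyond g (≤-<-trans w≤L L<P))
  shorten∈ : ∀ f → weight f ≡ w → IsPartition w (resize f)
  shorten∈ f |f| = trans (sym (weight-cong f (resize f) w≤L (λ P → sym (shorten f |f| P)))) |f|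
  lengthen∈ : ∀ g → IsPartition w g → weight (resize {L′ = L} g) ≡ w
  lengthen∈ g |g| = trans (weight-cong (resize g) g w≤L (lengthen g)) |g|
  lengthen-shorten : ∀ f → weight f ≡ w → resize (resize {L′ = w} f) ≡ f
  lengthen-shorten f |f| = freq-ext _ f λ p _ → trans (lengthen (resize f) (suc p)) (shorten f |f| (suc p))
  shorten-lengthen : ∀ g → IsPartition w g → resize (resize {L′ = L} g) ≡ g
  shorten-lengthen g |g| = freq-ext _ g λ p _ → trans (shorten (resize g) (lengthen∈ g |g|) (suc p)) (lengthen g (suc p))

∸-progression : ∀ {A B d} n → B < A → A ∣ d → d ≤ A * n + B → ∃[ n′ ] A * n + B ∸ d ≡ A * n′ + B
∸-progression {A} {B} n B<A (divides q refl) qA≤An+B = n ∸ q , (begin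
    A * n + B ∸ q * A    ≡⟨ +-∸-comm B qA≤An ⟩
    A * n ∸ q * A + B    ≡⟨ cong (λ z → A * n ∸ z + B) (*-comm q A) ⟩
    A * n ∸ A * q + B    ≡⟨ cong (_+ B) (*-distribˡ-∸ A n q) ⟨
    A * (n ∸ q) + B      ∎)
  where
  open ≡-Reasoning
  qA<[1+n]A : q * A < suc n * A
  qA<[1+n]A = ≤-<-trans qA≤An+B
    (subst (A * n + B <_) (trans (+-comm (A * n) A) (cong (A +_) (*-comm A n))) (+-monoʳ-< (A * n) B<A))
  qA≤An : q * A ≤ A * n
  qA≤An = subst (q * A ≤_) (*-comm n A) (*-monoˡ-≤ A (s≤s⁻¹ (*-cancelʳ-< A q (suc n) qA<[1+n]A)))

module Progression (m : ℕ) .{{_ : NonZero m}} {A B C : ℕ} (B<A : B < A) (A∣m : A ∣ m)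
         (C∣partitions : ∀ n → DividesCard C (IsPartition (A * n + B))) where

  InProgression : ℕ → Set
  InProgression w = ∃[ n ] w ≡ A * n + B

  FixedCountDivisible : ℕ → ℕ → Set
  FixedCountDivisible L w = w ≤ L → InProgression w → DividesCard C (Fibre m {L} w zeros)

  C∣Fibre-movingPart : ∀ {L w} (x : Vec ℕ L) → weight x ≡ w → w ≤ L → InProgression w →
    FixedCountDivisible L (w ∸ weight (movingPart m x)) → DividesCard C (Fibre m w (movingPart m x))
  C∣Fibre-movingPart {w = w} x |x| w≤L (n , refl) C∣fixed c card =
    C∣fixed (≤-trans (m∸n≤m w (weight (movingPart m x))) w≤L) (∸-progression n B<A A∣|moving| |moving|≤w) c
      (Card-Fibre-shift m (movingPart m x) (noFixedDigit-movingPart m x) |moving|≤w card)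
    where
    |moving|≤w : weight (movingPart m x) ≤ w
    |moving|≤w = subst (weight (movingPart m x) ≤_) |x| (weight-movingPart≤ m x)
    A∣|moving| : A ∣ weight (movingPart m x)
    A∣|moving| = ∣-trans A∣m (∣-weight m (movingPart m x) (noFixedDigit-movingPart m x))

  C∣fixedCount : ∀ {L} w → FixedCountDivisible L w
  C∣fixedCount {L} = <-rec (FixedCountDivisible L) step
    where
    step : ∀ w → (∀ {w′} → w′ < w → FixedCountDivisible L w′) → FixedCountDivisible L w
    step w IH w≤L w∈@(n , refl) with Card-weight L w
    ... | c , card = ∣-card-of-∣-complement (λ f → movingPart m f ≟ᵥ zeros) card
                       (DividesCard-resize w≤L (C∣partitions n) c card) C∣moving
      where
      shrinks : ∀ x → weight x ≡ w → ¬ movingPart m x ≡ zeros → w ∸ weight (movingPart m x) < w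
      shrinks x |x| x-moves = ∸-monoʳ-< {o = 0} (n≢0⇒n>0 (x-moves ∘ weight≡0⇒≡zeros _))
                                            (subst (weight (movingPart m x) ≤_) |x| (weight-movingPart≤ m x))

      C∣moving : DividesCard C (λ f → weight f ≡ w × ¬ movingPart m f ≡ zeros)
      C∣moving _ card′ = ∣-card-of-∣-fibres _≟ᵥ_ (movingPart m) card′ λ x (|x| , x-moves) →
        DividesCard-cong (λ y → mk⇔ (λ ((|y| , _) , y~x) → |y| , y~x)
                                    (λ (|y| , y~x) → (|y| , λ y-fixed → x-moves (trans (sym y~x) y-fixed)) , y~x))
          (C∣Fibre-movingPart x |x| w≤L w∈ (IH (shrinks x |x| x-moves)))

theorem1 : (m : ℕ) .{{_ : NonZero m}} → 2 ≤ m →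
    (A B C : ℕ) → 1 ≤ A → 1 ≤ C → B < A →
    ((n c : ℕ) → Card (IsPartition (A * n + B)) c → C ∣ c) →
    A ∣ m →
    (n k : ℕ) → 1 ≤ k → (c : ℕ) →
    Card (InOrbitOfSize m (A * n + B) k) c → C ∣ c
theorem1 m _ A B C _ _ B<A C∣partitions A∣m n k _ c card =
  ∣-card-of-∣-fibres _≟ᵥ_ (movingPart m) card λ x (|x| , x-orbit) →
    DividesCard-cong (orbit-fibre x x-orbit)
      (C∣Fibre-movingPart x |x| ≤-refl (n , refl) (C∣fixedCount _))
  where
  open Progression m B<A A∣m C∣partitions

  orbit-fibre : ∀ x → Card (Orbit m x) k → ∀ y →
    (InOrbitOfSize m (A * n + B) k y × movingPart m y ≡ movingPart m x) ⇔ Fibre m (A * n + B) (movingPart m x) y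
  orbit-fibre x x-orbit y = mk⇔ (λ ((|y| , _) , y~x) → |y| , y~x)
                                (λ (|y| , y~x) → (|y| , Card-Orbit-cong m x y (sym y~x) x-orbit) , y~x)
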